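{- Let $G$ be a connected graph, $X$ a minimum vertex cover of $G$, and $\ell, d$ integers. Suppose some vertex $x^\circ \in X$ is adjacent to a pendant vertex (a vertex of degree $1$). Suppose there are subsets $X_s \subseteq X$ and $Y_s \subseteq V(G)\setminus X$ such that (i) $(X\setminus X_s)\cup Y_s$ is a vertex cover of $G$, (ii) $\mathrm{rank}((X\setminus X_s)\cup Y_s) \ge \ell$, and (iii) $|Y_s|-|X_s| \le \ell - d$. Then there are subsets $X'_s \subseteq X$ and $Y'_s \subseteq V(G)\setminus X$ satisfying (i), (ii), (iii) (with $X'_s, Y'_s$ in place of $X_s, Y_s$) and $x^\circ \notin X'_s$.
   Context: All graphs are finite, simple and undirected. $\mathrm{rank}(H)$ is the number of vertices of a graph $H$ minus its number of connected components; for $S \subseteq V(G)$, $\mathrm{rank}(S) := \mathrm{rank}(G[S])$. -}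

module Defs where

open import Data.Nat using (ℕ)
open import Data.Integer using (ℤ; +_; _-_; _≤_)
open import Data.Bool using (Bool; true; false)
open import Data.Fin using (Fin)
open import Data.Fin.Subset using (Subset; _∈_; _⊆_; ∁; _∪_; _─_; ∣_∣; ⊤)
open import Data.Vec using (tabulate)
open import Data.Product using (Σ; ∃; _×_; _,_)
open import Data.Sum using (_⊎_)
open import Function.Bundles using (_⇔_)
open import Relation.Binary.PropositionalEquality using (_≡_)

record Graph : Set where
  field
    n     : ℕ
    adj   : Fin n → Fin n → Bool
    irrefl : ∀ v → adj v v ≡ false
    sym   : ∀ u v → adj u v ≡ adj v u
open Graph public

data Walk (G : Graph) (S : Subset (n G)) : Fin (n G) → Fin (n G) → Set where
  here : ∀ {u} → u ∈ S → Walk G S u u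
  step : ∀ {u w v} → u ∈ S → adj G u w ≡ true → Walk G S w v → Walk G S u v

Connected : Graph → Set
Connected G = ∀ u v → Walk G ⊤ u v

degree : (G : Graph) → Fin (n G) → ℕ
degree G v = ∣ tabulate (adj G v) ∣

IsVertexCover : (G : Graph) → Subset (n G) → Set
IsVertexCover G C = ∀ u v → adj G u v ≡ true → u ∈ C ⊎ v ∈ C

IsMinimumVertexCover : (G : Graph) → Subset (n G) → Set
IsMinimumVertexCover G X =
  IsVertexCover G X × (∀ C → IsVertexCover G C → Data.Nat._≤_ ∣ X ∣ ∣ C ∣)

-- G[S] has exactly k connected components: a labelling of the vertices of
-- S by Fin k whose fibres (within S) are exactly the connectivity classes
-- of G[S], and every label is used.
NumComponents : (G : Graph) → Subset (n G) → ℕ → Set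
NumComponents G S k =
  Σ (Fin (n G) → Fin k) λ f →
    (∀ u v → u ∈ S → v ∈ S → (f u ≡ f v) ⇔ Walk G S u v)
    × (∀ c → ∃ λ u → u ∈ S × f u ≡ c)

HasRank : (G : Graph) → Subset (n G) → ℕ → Set
HasRank G S r = ∃ λ k → NumComponents G S k × (Data.Nat._+_ r k ≡ ∣ S ∣)

RankAtLeast : (G : Graph) → Subset (n G) → ℤ → Set
RankAtLeast G S ℓ = ∃ λ r → HasRank G S r × (ℓ ≤ + r)

Good : (G : Graph) → Subset (n G) → ℤ → ℤ → Subset (n G) → Subset (n G) → Set
Good G X ℓ d Xs Ys =
  Xs ⊆ X × Ys ⊆ ∁ X
  × IsVertexCover G ((X ─ Xs) ∪ Ys)
  × RankAtLeast G ((X ─ Xs) ∪ Ys) ℓ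
  × ((+ ∣ Ys ∣) - (+ ∣ Xs ∣) ≤ ℓ - d)

-- A minimum vertex cover X cannot contain the pendant neighbour p of x° ∈ X. So if x° ∈ Xs, the
-- cover (X ∖ Xs) ∪ Ys reaches the edge x°p only through p ∈ Ys, and p is an isolated vertex of
-- the subgraph it induces. Trading p for x°, i.e. passing to Xs − x° and Ys − p, keeps a vertex
-- cover of the same size and keeps |Ys| − |Xs|. Deleting the isolated vertex p frees its component
-- label; x° takes it over and merges with every component it touches, so the number of components
-- does not grow and the rank does not drop.

module Submission where

open import Defs
open import Data.Integer using (ℤ)
open import Data.Bool using (true)
open import Data.Fin.Subset using (Subset; _∈_; _∉_)
open import Data.Product using (∃; ∃₂; _×_)
open import Relation.Binary.PropositionalEquality using (_≡_)

open import Data.Nat as ℕ using (zero; suc)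
import Data.Nat.Properties as ℕ
import Data.Integer as ℤ
import Data.Integer.Properties as ℤ
import Data.Bool as Bool
open import Data.Fin using (Fin; _≟_; punchOut)
open import Data.Fin.Properties using (any?; all?; ¬∀⟶∃¬; punchOut-cong; punchOut-injective)
open import Data.Fin.Subset using (_⊆_; ∁; _∪_; _─_; ∣_∣; ⁅_⁆; _-_; inside; outside)
open import Data.Fin.Subset.Properties
  using (_∈?_; p─⊥≡p; p─q⊆p; p⊆p∪q; q⊆p∪q; x∈p∪q⁻; x∈p∪q⁺; x∈p∧x∉q⇒x∈p─q; x∈p∧x≢y⇒x∈p-y;
         x∈⁅x⁆; x∈⁅y⁆⇒x≡y; x∈∁p⇒x∉p; x∈p⇒∣p-x∣<∣p∣; p⊆q⇒∣p∣≤∣q∣; ⊆-antisym)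
open import Data.Vec using (_∷_; tabulate; here; there)
open import Data.Vec.Properties using (lookup⇒[]=; lookup∘tabulate)
open import Data.Product using (Σ; _,_)
open import Data.Sum using (_⊎_; inj₁; inj₂) renaming (swap to ⊎-swap)
open import Data.Empty using (⊥-elim)
open import Relation.Nullary using (Dec; yes; no)
open import Relation.Nullary.Negation using (contradiction)
open import Relation.Nullary.Decidable using (_×-dec_)
open import Relation.Binary.PropositionalEquality as ≡ using (refl; cong; subst; trans; _≢_; ≢-sym)
open import Function.Base using (_∘_)
open import Function.Bundles using (_⇔_; Equivalence; mk⇔)

∣p∣≡1+∣p-x∣ : ∀ {m} {p : Subset m} {x} → x ∈ p → ∣ p ∣ ≡ suc ∣ p - x ∣
∣p∣≡1+∣p-x∣ {p = inside ∷ p} here = cong (suc ∘ ∣_∣) (≡.sym (p─⊥≡p p))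
∣p∣≡1+∣p-x∣ {p = outside ∷ p} (there x∈p) = ∣p∣≡1+∣p-x∣ x∈p
∣p∣≡1+∣p-x∣ {p = inside ∷ p} (there x∈p) = cong suc (∣p∣≡1+∣p-x∣ x∈p)

x∈p─q⇒x∉q : ∀ {m} (p q : Subset m) {x} → x ∈ p ─ q → x ∉ q
x∈p─q⇒x∉q (_ ∷ p) (outside ∷ q) here = λ ()
x∈p─q⇒x∉q (_ ∷ p) (_ ∷ q) (there x∈p─q) (there x∈q) = x∈p─q⇒x∉q p q x∈p─q x∈q

x∈p-y⇒x≢y : ∀ {m} (p : Subset m) {x y} → x ∈ p - y → x ≢ y
x∈p-y⇒x≢y p {x} x∈p-x refl = x∈p─q⇒x∉q p ⁅ x ⁆ x∈p-x (x∈⁅x⁆ x)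

x∉p-x : ∀ {m} (p : Subset m) {x} → x ∉ p - x
x∉p-x p x∈p-x = x∈p-y⇒x≢y p x∈p-x refl

x∉p⇒1+∣p∣≤∣p∪⁅x⁆∣ : ∀ {m} {p : Subset m} {x} → x ∉ p → suc ∣ p ∣ ℕ.≤ ∣ p ∪ ⁅ x ⁆ ∣
x∉p⇒1+∣p∣≤∣p∪⁅x⁆∣ {p = p} {x} x∉p =
  subst (suc ∣ p ∣ ℕ.≤_) (≡.sym (∣p∣≡1+∣p-x∣ (q⊆p∪q p _ (x∈⁅x⁆ x))))
    (ℕ.s≤s (p⊆q⇒∣p∣≤∣q∣ p⊆p∪⁅x⁆-x))
  where
  p⊆p∪⁅x⁆-x : p ⊆ (p ∪ ⁅ x ⁆) - x
  p⊆p∪⁅x⁆-x u∈p = x∈p∧x≢y⇒x∈p-y (p⊆p∪q _ u∈p) λ { refl → x∉p u∈p }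

module _ (G : Graph) where

  adj⇒≢ : ∀ {u w} → adj G u w ≡ true → u ≢ w
  adj⇒≢ {u} uw refl with trans (≡.sym uw) (irrefl G u)
  ... | ()

  adj-sym : ∀ {u w} → adj G u w ≡ true → adj G w u ≡ true
  adj-sym {u} {w} uw = trans (sym G w u) uw

  adj⇒∈neighbours : ∀ {p u} → adj G p u ≡ true → u ∈ tabulate (adj G p)
  adj⇒∈neighbours {p} {u} pu = lookup⇒[]= u _ (trans (lookup∘tabulate (adj G p) u) pu)

  degree≡1⇒unique-neighbour : ∀ {p x} → degree G p ≡ 1 → adj G p x ≡ true
    → ∀ q → adj G p q ≡ true → q ≡ x
  degree≡1⇒unique-neighbour {p} {x} deg px q pq with q ≟ x
  ... | yes q≡x = q≡x
  ... | no q≢x with trans (≡.sym deg) (trans (∣p∣≡1+∣p-x∣ x∈N) (cong suc (∣p∣≡1+∣p-x∣ q∈N-x)))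
    where
    x∈N : x ∈ tabulate (adj G p)
    x∈N = adj⇒∈neighbours px
    q∈N-x : q ∈ tabulate (adj G p) - x
    q∈N-x = x∈p∧x≢y⇒x∈p-y (adj⇒∈neighbours pq) q≢x
  ...   | ()

module _ {G : Graph} where

  module _ {S : Subset (n G)} where

    head∈ : ∀ {u v} → Walk G S u v → u ∈ S
    head∈ (here u∈S) = u∈S
    head∈ (step u∈S _ _) = u∈S

    _◅◅_ : ∀ {u v w} → Walk G S u v → Walk G S v w → Walk G S u w
    here _ ◅◅ r = r
    step u∈S uw q ◅◅ r = step u∈S uw (q ◅◅ r)

    reverse : ∀ {u v} → Walk G S u v → Walk G S v u
    reverse (here u∈S) = here u∈S
    reverse (step u∈S uw q) = reverse q ◅◅ step (head∈ q) (adj-sym G uw) (here u∈S)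

  walk-mono : ∀ {S T} → S ⊆ T → ∀ {u v} → Walk G S u v → Walk G T u v
  walk-mono S⊆T (here u∈S) = here (S⊆T u∈S)
  walk-mono S⊆T (step u∈S uw q) = step (S⊆T u∈S) uw (walk-mono S⊆T q)

module _ (G : Graph) where

  swap-covers-edge : ∀ {C p x u w} → (∀ q → adj G p q ≡ true → q ≡ x) → u ∈ C → adj G u w ≡ true
    → u ∈ (C - p) ∪ ⁅ x ⁆ ⊎ w ∈ (C - p) ∪ ⁅ x ⁆
  swap-covers-edge {p = p} {x} {u} {w} only-x u∈C uw with u ≟ p
  ... | yes refl = inj₂ (x∈p∪q⁺ (inj₂ (subst (_∈ ⁅ x ⁆) (≡.sym (only-x w uw)) (x∈⁅x⁆ x))))
  ... | no u≢p = inj₁ (x∈p∪q⁺ (inj₁ (x∈p∧x≢y⇒x∈p-y u∈C u≢p)))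

  cover-swap : ∀ {C p x} → IsVertexCover G C → (∀ q → adj G p q ≡ true → q ≡ x)
    → IsVertexCover G ((C - p) ∪ ⁅ x ⁆)
  cover-swap cov only-x u w uw with cov u w uw
  ... | inj₁ u∈C = swap-covers-edge only-x u∈C uw
  ... | inj₂ w∈C = ⊎-swap (swap-covers-edge only-x w∈C (adj-sym G uw))

  -- Trading p for its neighbour x ∈ X yields a vertex cover inside X − p.
  pendant∉minimum-cover : ∀ {X p x} → IsMinimumVertexCover G X → x ∈ X
    → adj G p x ≡ true → (∀ q → adj G p q ≡ true → q ≡ x) → p ∉ X
  pendant∉minimum-cover {X} {p} {x} (cov , minimum) x∈X px only-x p∈X =
    ℕ.<⇒≱ (x∈p⇒∣p-x∣<∣p∣ p∈X)
      (ℕ.≤-trans (minimum _ (cover-swap cov only-x)) (p⊆q⇒∣p∣≤∣q∣ swapped⊆X-p))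
    where
    swapped⊆X-p : (X - p) ∪ ⁅ x ⁆ ⊆ X - p
    swapped⊆X-p u∈ with x∈p∪q⁻ (X - p) ⁅ x ⁆ u∈
    ... | inj₁ u∈X-p = u∈X-p
    ... | inj₂ u∈⁅x⁆ rewrite x∈⁅y⁆⇒x≡y x u∈⁅x⁆ = x∈p∧x≢y⇒x∈p-y x∈X (≢-sym (adj⇒≢ G px))

IsComponentLabelling : (G : Graph) → Subset (n G) → ∀ {k} → (Fin (n G) → Fin k) → Set
IsComponentLabelling G S f = ∀ u v → u ∈ S → v ∈ S → (f u ≡ f v) ⇔ Walk G S u v

module _ {G : Graph} {S : Subset (n G)} where

  drop-unused-label : ∀ {k w} → w ∈ S → (f : Fin (n G) → Fin (suc k)) → IsComponentLabelling G S f
    → (c : Fin (suc k)) → (∀ {u} → u ∈ S → c ≢ f u)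
    → Σ (Fin (n G) → Fin k) (IsComponentLabelling G S)
  drop-unused-label {k} {w} w∈S f classes c unused = f′ , classes′
    where
    f′ : Fin (n G) → Fin k
    f′ u with u ∈? S
    ... | yes u∈S = punchOut (unused u∈S)
    ... | no _ = punchOut (unused w∈S)

    f′-on-S : ∀ {u} (u∈S : u ∈ S) → f′ u ≡ punchOut (unused u∈S)
    f′-on-S {u} u∈S with u ∈? S
    ... | yes _ = punchOut-cong c refl
    ... | no u∉S = contradiction u∈S u∉S

    classes′ : IsComponentLabelling G S f′
    classes′ u v u∈S v∈S = mk⇔
      (λ eq → Equivalence.to (classes u v u∈S v∈S)
        (punchOut-injective (unused u∈S) (unused v∈S) (trans (≡.sym (f′-on-S u∈S)) (trans eq (f′-on-S v∈S)))))
      (λ walk → trans (f′-on-S u∈S)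
        (trans (punchOut-cong c (Equivalence.from (classes u v u∈S v∈S) walk)) (≡.sym (f′-on-S v∈S))))

  label-used? : ∀ {k} (f : Fin (n G) → Fin k) c → Dec (∃ λ u → u ∈ S × f u ≡ c)
  label-used? f c = any? λ u → (u ∈? S) ×-dec (f u ≟ c)

  -- The witness w is needed: the empty graph G[∅] on a nonempty vertex set has no labelling by Fin 0.
  components-≤ : ∀ {k w} → w ∈ S → (f : Fin (n G) → Fin k) → IsComponentLabelling G S f
    → ∃ λ k′ → k′ ℕ.≤ k × NumComponents G S k′
  components-≤ {zero} {w} _ f _ with f w
  ... | ()
  components-≤ {suc k} w∈S f classes with all? (label-used? f)
  ... | yes used = suc k , ℕ.≤-refl , f , classes , used
  ... | no ¬used with ¬∀⟶∃¬ _ _ (label-used? f) ¬used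
  ...   | c , unused with drop-unused-label w∈S f classes c (λ u∈S c≡fu → unused (_ , u∈S , ≡.sym c≡fu))
  ...     | f′ , classes′ with components-≤ w∈S f′ classes′
  ...       | k′ , k′≤k , components = k′ , ℕ.m≤n⇒m≤1+n k′≤k , components

module _ {G : Graph} {S : Subset (n G)} {p : Fin (n G)} (isolated : ∀ q → adj G p q ≡ true → q ∉ S) where

  walk-from-isolated : ∀ {v} → Walk G S p v → v ≡ p
  walk-from-isolated (here _) = refl
  walk-from-isolated (step _ pw q) = ⊥-elim (isolated _ pw (head∈ q))

  walk-avoids-isolated : ∀ {u v} → u ≢ p → Walk G S u v → Walk G (S - p) u v
  walk-avoids-isolated u≢p (here u∈S) = here (x∈p∧x≢y⇒x∈p-y u∈S u≢p)
  walk-avoids-isolated {u} u≢p (step u∈S uw q) =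
    step (x∈p∧x≢y⇒x∈p-y u∈S u≢p) uw (walk-avoids-isolated w≢p q)
    where
    w≢p : _ ≢ p
    w≢p refl = isolated u (adj-sym G uw) u∈S

  module _ {k} {f : Fin (n G) → Fin k} (classes : IsComponentLabelling G S f) (p∈S : p ∈ S) where

    remove-isolated : IsComponentLabelling G (S - p) f
    remove-isolated u v u∈ v∈ = mk⇔
      (λ eq → walk-avoids-isolated (x∈p-y⇒x≢y S u∈) (Equivalence.to (classes u v u∈S v∈S) eq))
      (λ walk → Equivalence.from (classes u v u∈S v∈S) (walk-mono (p─q⊆p S _) walk))
      where
      u∈S : u ∈ S
      u∈S = p─q⊆p S _ u∈
      v∈S : v ∈ S
      v∈S = p─q⊆p S _ v∈

    isolated-label-unused : ∀ {u} → u ∈ S - p → f p ≢ f u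
    isolated-label-unused {u} u∈ eq =
      x∈p-y⇒x≢y S u∈ (walk-from-isolated (Equivalence.to (classes p u p∈S (p─q⊆p S _ u∈)) eq))

-- Adding x to S merges x with every component it touches; a label c unused on S names the merged component.
module JoinVertex {G : Graph} {S : Subset (n G)} {k} {f : Fin (n G) → Fin k}
  (classes : IsComponentLabelling G S f) (x : Fin (n G)) (c : Fin k) (unused : ∀ {u} → u ∈ S → c ≢ f u) where

  Touches : Fin k → Set
  Touches l = ∃ λ a → a ∈ S × adj G x a ≡ true × f a ≡ l

  touches? : ∀ l → Dec (Touches l)
  touches? l = any? λ a → (a ∈? S) ×-dec (adj G x a Bool.≟ true) ×-dec (f a ≟ l)

  merge : Fin k → Fin k
  merge l with touches? l
  ... | yes _ = c
  ... | no _ = l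

  joined : Fin (n G) → Fin k
  joined u with u ≟ x
  ... | yes _ = c
  ... | no _ = merge (f u)

  merge-touching : ∀ {l} → Touches l → merge l ≡ c
  merge-touching {l} t with touches? l
  ... | yes _ = refl
  ... | no ¬t = contradiction t ¬t

  merge≡c⇒touching : ∀ {u} → u ∈ S → merge (f u) ≡ c → Touches (f u)
  merge≡c⇒touching {u} u∈S eq with touches? (f u)
  ... | yes t = t
  ... | no _ = contradiction (≡.sym eq) (unused u∈S)

  S⁺ : Subset (n G)
  S⁺ = S ∪ ⁅ x ⁆

  x∈S⁺ : x ∈ S⁺
  x∈S⁺ = q⊆p∪q S _ (x∈⁅x⁆ x)

  ∈S⁺⇒∈S : ∀ {u} → u ∈ S⁺ → u ≢ x → u ∈ S
  ∈S⁺⇒∈S u∈ u≢x with x∈p∪q⁻ S _ u∈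
  ... | inj₁ u∈S = u∈S
  ... | inj₂ u∈⁅x⁆ = contradiction (x∈⁅y⁆⇒x≡y x u∈⁅x⁆) u≢x

  walk-to-x : ∀ {u} → u ∈ S → Touches (f u) → Walk G S⁺ u x
  walk-to-x {u} u∈S (a , a∈S , xa , fa≡fu) =
    walk-mono (p⊆p∪q _) (Equivalence.to (classes u a u∈S a∈S) (≡.sym fa≡fu))
    ◅◅ step (p⊆p∪q _ a∈S) (adj-sym G xa) (here x∈S⁺)

  merge⇒walk : ∀ {u v} → u ∈ S → v ∈ S → merge (f u) ≡ merge (f v) → Walk G S⁺ u v
  merge⇒walk {u} {v} u∈S v∈S eq with touches? (f u) | touches? (f v)
  ... | yes tu | yes tv = walk-to-x u∈S tu ◅◅ reverse (walk-to-x v∈S tv)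
  ... | yes _ | no _ = contradiction eq (unused v∈S)
  ... | no _ | yes _ = contradiction (≡.sym eq) (unused u∈S)
  ... | no _ | no _ = walk-mono (p⊆p∪q _) (Equivalence.to (classes u v u∈S v∈S) eq)

  edge⇒joined : ∀ {u w} → u ∈ S⁺ → w ∈ S⁺ → adj G u w ≡ true → joined u ≡ joined w
  edge⇒joined {u} {w} u∈ w∈ uw with u ≟ x | w ≟ x
  ... | yes _ | yes _ = refl
  ... | yes refl | no w≢x = ≡.sym (merge-touching (w , ∈S⁺⇒∈S w∈ w≢x , uw , refl))
  ... | no u≢x | yes refl = merge-touching (u , ∈S⁺⇒∈S u∈ u≢x , adj-sym G uw , refl)
  ... | no u≢x | no w≢x = cong merge (Equivalence.from (classes u w u∈S w∈S) (step u∈S uw (here w∈S)))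
    where
    u∈S : u ∈ S
    u∈S = ∈S⁺⇒∈S u∈ u≢x
    w∈S : w ∈ S
    w∈S = ∈S⁺⇒∈S w∈ w≢x

  walk⇒joined : ∀ {u v} → Walk G S⁺ u v → joined u ≡ joined v
  walk⇒joined (here _) = refl
  walk⇒joined (step u∈ uw q) = trans (edge⇒joined u∈ (head∈ q) uw) (walk⇒joined q)

  joined⇒walk : ∀ {u v} → u ∈ S⁺ → v ∈ S⁺ → joined u ≡ joined v → Walk G S⁺ u v
  joined⇒walk {u} {v} u∈ v∈ eq with u ≟ x | v ≟ x
  ... | yes refl | yes refl = here u∈
  ... | yes refl | no v≢x = reverse (walk-to-x v∈S (merge≡c⇒touching v∈S (≡.sym eq)))
    where
    v∈S : v ∈ S
    v∈S = ∈S⁺⇒∈S v∈ v≢x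
  ... | no u≢x | yes refl = walk-to-x u∈S (merge≡c⇒touching u∈S eq)
    where
    u∈S : u ∈ S
    u∈S = ∈S⁺⇒∈S u∈ u≢x
  ... | no u≢x | no v≢x = merge⇒walk (∈S⁺⇒∈S u∈ u≢x) (∈S⁺⇒∈S v∈ v≢x) eq

  joined-isComponentLabelling : IsComponentLabelling G S⁺ joined
  joined-isComponentLabelling u v u∈ v∈ = mk⇔ (joined⇒walk u∈ v∈) walk⇒joined

swap-isolated-components : ∀ {G : Graph} {S p k} {f : Fin (n G) → Fin k}
  → IsComponentLabelling G S f → p ∈ S → (∀ q → adj G p q ≡ true → q ∉ S)
  → ∀ x → ∃ λ k′ → k′ ℕ.≤ k × NumComponents G ((S - p) ∪ ⁅ x ⁆) k′
swap-isolated-components {p = p} {f = f} classes p∈S isolated x =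
  components-≤ x∈S⁺ joined joined-isComponentLabelling
  where
  open JoinVertex (remove-isolated isolated classes p∈S) x (f p) (isolated-label-unused isolated classes p∈S)

rank-≥-of-fewer-components : ∀ {G : Graph} {S T : Subset (n G)} {r k k′}
  → r ℕ.+ k ≡ ∣ S ∣ → ∣ S ∣ ℕ.≤ ∣ T ∣ → k′ ℕ.≤ k → NumComponents G T k′
  → ∃ λ r′ → HasRank G T r′ × r ℕ.≤ r′
rank-≥-of-fewer-components {T = T} {r} {k} {k′} r+k≡∣S∣ ∣S∣≤∣T∣ k′≤k components =
  ∣ T ∣ ℕ.∸ k′ , (k′ , components , ℕ.m∸n+n≡m k′≤∣T∣) , ℕ.m+n≤o⇒m≤o∸n r r+k′≤∣T∣
  where
  r+k≤∣T∣ : r ℕ.+ k ℕ.≤ ∣ T ∣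
  r+k≤∣T∣ = ℕ.≤-trans (ℕ.≤-reflexive r+k≡∣S∣) ∣S∣≤∣T∣
  r+k′≤∣T∣ : r ℕ.+ k′ ℕ.≤ ∣ T ∣
  r+k′≤∣T∣ = ℕ.≤-trans (ℕ.+-monoʳ-≤ r k′≤k) r+k≤∣T∣
  k′≤∣T∣ : k′ ℕ.≤ ∣ T ∣
  k′≤∣T∣ = ℕ.m+n≤o⇒n≤o r r+k′≤∣T∣

+[1+m]-+[1+n]≡+m-+n : ∀ m n → ℤ.+ suc m ℤ.- ℤ.+ suc n ≡ ℤ.+ m ℤ.- ℤ.+ n
+[1+m]-+[1+n]≡+m-+n m n = begin
  ℤ.+ suc m ℤ.- ℤ.+ suc n ≡⟨ ℤ.[+m]-[+n]≡m⊖n (suc m) (suc n) ⟩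
  suc m ℤ.⊖ suc n         ≡⟨ ℤ.[1+m]⊖[1+n]≡m⊖n m n ⟩
  m ℤ.⊖ n                 ≡⟨ ℤ.[+m]-[+n]≡m⊖n m n ⟨
  ℤ.+ m ℤ.- ℤ.+ n         ∎
  where open ≡.≡-Reasoning

module PendantSwap {G : Graph} {X : Subset (n G)} (minimum : IsMinimumVertexCover G X)
  {x° p : Fin (n G)} (x°∈X : x° ∈ X) (x°p : adj G x° p ≡ true) (deg-p : degree G p ≡ 1)
  {Xs Ys : Subset (n G)} (Ys⊆∁X : Ys ⊆ ∁ X) (x°∈Xs : x° ∈ Xs) where

  C C′ : Subset (n G)
  C = (X ─ Xs) ∪ Ys
  C′ = (C - p) ∪ ⁅ x° ⁆

  only-x° : ∀ q → adj G p q ≡ true → q ≡ x°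
  only-x° = degree≡1⇒unique-neighbour G deg-p (adj-sym G x°p)

  p∉X : p ∉ X
  p∉X = pendant∉minimum-cover G minimum x°∈X (adj-sym G x°p) only-x°

  x°∉C : x° ∉ C
  x°∉C x°∈C with x∈p∪q⁻ (X ─ Xs) Ys x°∈C
  ... | inj₁ x°∈X─Xs = x∈p─q⇒x∉q X Xs x°∈X─Xs x°∈Xs
  ... | inj₂ x°∈Ys = x∈∁p⇒x∉p (Ys⊆∁X x°∈Ys) x°∈X

  X─[Xs-x°]∪[Ys-p]≡C′ : (X ─ (Xs - x°)) ∪ (Ys - p) ≡ C′
  X─[Xs-x°]∪[Ys-p]≡C′ = ⊆-antisym ⊆C′ C′⊆
    where
    ⊆C′ : (X ─ (Xs - x°)) ∪ (Ys - p) ⊆ C′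
    ⊆C′ {u} u∈ with x∈p∪q⁻ (X ─ (Xs - x°)) (Ys - p) u∈ | u ≟ x°
    ... | _ | yes refl = x∈p∪q⁺ (inj₂ (x∈⁅x⁆ x°))
    ... | inj₁ u∈X─ | no u≢x° =
      x∈p∪q⁺ (inj₁ (x∈p∧x≢y⇒x∈p-y (x∈p∪q⁺ (inj₁ (x∈p∧x∉q⇒x∈p─q u∈X u∉Xs))) u≢p))
      where
      u∈X : u ∈ X
      u∈X = p─q⊆p X _ u∈X─
      u∉Xs : u ∉ Xs
      u∉Xs u∈Xs = x∈p─q⇒x∉q X _ u∈X─ (x∈p∧x≢y⇒x∈p-y u∈Xs u≢x°)
      u≢p : u ≢ p
      u≢p refl = p∉X u∈X
    ... | inj₂ u∈Ys-p | no _ =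
      x∈p∪q⁺ (inj₁ (x∈p∧x≢y⇒x∈p-y (x∈p∪q⁺ (inj₂ (p─q⊆p Ys _ u∈Ys-p))) (x∈p-y⇒x≢y Ys u∈Ys-p)))

    C′⊆ : C′ ⊆ (X ─ (Xs - x°)) ∪ (Ys - p)
    C′⊆ {u} u∈ with x∈p∪q⁻ (C - p) ⁅ x° ⁆ u∈
    ... | inj₂ u∈⁅x°⁆ rewrite x∈⁅y⁆⇒x≡y x° u∈⁅x°⁆ =
      x∈p∪q⁺ (inj₁ (x∈p∧x∉q⇒x∈p─q x°∈X (x∉p-x Xs)))
    ... | inj₁ u∈C-p with x∈p∪q⁻ (X ─ Xs) Ys (p─q⊆p C _ u∈C-p)
    ...   | inj₁ u∈X─Xs =
      x∈p∪q⁺ (inj₁ (x∈p∧x∉q⇒x∈p─q (p─q⊆p X Xs u∈X─Xs) (x∈p─q⇒x∉q X Xs u∈X─Xs ∘ p─q⊆p Xs _)))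
    ...   | inj₂ u∈Ys = x∈p∪q⁺ (inj₂ (x∈p∧x≢y⇒x∈p-y u∈Ys (x∈p-y⇒x≢y C u∈C-p)))

  p-isolated-in-C : ∀ q → adj G p q ≡ true → q ∉ C
  p-isolated-in-C q pq = subst (_∉ C) (≡.sym (only-x° q pq)) x°∉C

  p∈Ys : IsVertexCover G C → p ∈ Ys
  p∈Ys cov with cov x° p x°p
  ... | inj₁ x°∈C = contradiction x°∈C x°∉C
  ... | inj₂ p∈C with x∈p∪q⁻ (X ─ Xs) Ys p∈C
  ...   | inj₁ p∈X─Xs = contradiction (p─q⊆p X Xs p∈X─Xs) p∉X
  ...   | inj₂ p∈Ys = p∈Ys

  ∣C∣≤∣C′∣ : p ∈ C → ∣ C ∣ ℕ.≤ ∣ C′ ∣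
  ∣C∣≤∣C′∣ p∈C =
    ℕ.≤-trans (ℕ.≤-reflexive (∣p∣≡1+∣p-x∣ p∈C)) (x∉p⇒1+∣p∣≤∣p∪⁅x⁆∣ (x°∉C ∘ p─q⊆p C _))

  rank-C′ : ∀ {ℓ} → RankAtLeast G C ℓ → p ∈ C → RankAtLeast G C′ ℓ
  rank-C′ (r , (k , (f , classes , _) , r+k≡∣C∣) , ℓ≤r) p∈C
    with swap-isolated-components {S = C} classes p∈C p-isolated-in-C x°
  ... | k′ , k′≤k , components
    with rank-≥-of-fewer-components {S = C} r+k≡∣C∣ (∣C∣≤∣C′∣ p∈C) k′≤k components
  ...   | r′ , rank , r≤r′ = r′ , rank , ℤ.≤-trans ℓ≤r (ℤ.+≤+ r≤r′)

  swap-good : ∀ {ℓ d} → Good G X ℓ d Xs Ys → Good G X ℓ d (Xs - x°) (Ys - p)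
  swap-good (Xs⊆X , _ , cov , rank , balance) =
    Xs⊆X ∘ p─q⊆p Xs _ ,
    Ys⊆∁X ∘ p─q⊆p Ys _ ,
    subst (IsVertexCover G) (≡.sym X─[Xs-x°]∪[Ys-p]≡C′) (cover-swap G cov only-x°) ,
    subst (λ S → RankAtLeast G S _) (≡.sym X─[Xs-x°]∪[Ys-p]≡C′) (rank-C′ rank p∈C) ,
    subst (ℤ._≤ _) balance-unchanged balance
    where
    p∈C : p ∈ C
    p∈C = q⊆p∪q (X ─ Xs) Ys (p∈Ys cov)
    balance-unchanged : ℤ.+ ∣ Ys ∣ ℤ.- ℤ.+ ∣ Xs ∣ ≡ ℤ.+ ∣ Ys - p ∣ ℤ.- ℤ.+ ∣ Xs - x° ∣
    balance-unchanged rewrite ∣p∣≡1+∣p-x∣ (p∈Ys cov) | ∣p∣≡1+∣p-x∣ x°∈Xs =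
      +[1+m]-+[1+n]≡+m-+n ∣ Ys - p ∣ ∣ Xs - x° ∣

lemma2 : (G : Graph) → Connected G → (X : Subset (n G)) → IsMinimumVertexCover G X
    → (ℓ d : ℤ) → (x° : _) → x° ∈ X
    → (∃ λ p → adj G x° p ≡ true × degree G p ≡ 1)
    → (∃₂ λ Xs Ys → Good G X ℓ d Xs Ys)
    → ∃₂ λ Xs′ Ys′ → Good G X ℓ d Xs′ Ys′ × x° ∉ Xs′
lemma2 G _ X minimum ℓ d x° x°∈X (p , x°p , deg-p) (Xs , Ys , good@(_ , Ys⊆∁X , _))
  with x° ∈? Xs
... | no x°∉Xs = Xs , Ys , good , x°∉Xs
... | yes x°∈Xs =
  Xs - x° , Ys - p , swap-good good , x∉p-x Xs
  where
  open PendantSwap minimum x°∈X x°p deg-p Ys⊆∁X x°∈Xs
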